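{- Let $k\geq 4$ and let $\mathbf{u}=\xi^\omega(0)$ be as in the context. Then $\mathbf{u}$ contains no overlaps (no factor $z=u^r$ with $u$ non-empty and $r>2$) and contains squares $uu$ of unboundedly large length. Hence the critical exponent and the asymptotic critical exponent of $\mathbf{u}$ both equal $2$.
   Context: Fix an integer $k\geq 4$. Let $\mathcal{A}=\{0,1,\ldots,k-1,0',1',\ldots,(k-1)'\}$. Let $\xi:\mathcal{A}^*\to\mathcal{A}^*$ be the morphism given by $\xi(0)=01$, $\xi(j)=j+1$ for $1\leq j\leq k-2$, $\xi(k-1)=0'$, and $\xi(0')=0'1'$, $\xi(j')=(j+1)'$ for $1\leq j\leq k-2$, $\xi((k-1)')=0$. Let $\mathbf{u}=\xi^\omega(0)$ be the infinite fixed point of $\xi$ starting with $0$. A word $z$ of length $p$ equals $u^{p/q}$ ($|u|=q\geq1$) if $z$ is a prefix of $u^\omega$. The critical exponent is $E(\mathbf{v})=\sup\{r\in\mathbb{Q}:u^r\text{ non-empty factor of }\mathbf{v}\}$, and the asymptotic critical exponent is $E^*(\mathbf{v})=\lim_{n\to\infty}\sup\{r: u^r \text{ non-empty factor of }\mathbf{v},\ |u|\geq n\}$. -}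

module Defs where

open import Data.Nat using (ℕ; zero; suc; _+_; _*_; _≤_; _<_; _≟_)
open import Data.Bool using (Bool; true; false; not)
open import Data.Product using (_×_; _,_; ∃-syntax)
open import Data.List using (List; []; _∷_; concatMap)
open import Data.Integer using (+_)
open import Data.Rational using (ℚ; _/_; _-_; ∣_∣) renaming (_≤_ to _≤ℚ_; _<_ to _<ℚ_)
open import Data.Rational using (0ℚ)
open import Relation.Binary.PropositionalEquality using (_≡_)
open import Relation.Nullary using (yes; no)

-- Letters of the alphabet A = {0,...,k-1, 0',...,(k-1)'}:
-- (j , false) stands for j and (j , true) stands for j'.
-- (Only indices j < k occur in the words considered below.)
Letter : Set
Letter = ℕ × Bool

-- The morphism ξ on letters (for the parameter k):
--   ξ(0) = 01, ξ(j) = j+1 (1 ≤ j ≤ k-2), ξ(k-1) = 0'   and the primed analogues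
--   ξ(0') = 0'1', ξ(j') = (j+1)', ξ((k-1)') = 0.
ξ : ℕ → Letter → List Letter
ξ k (zero , b) = (0 , b) ∷ (1 , b) ∷ []
ξ k (suc j , b) with suc (suc j) ≟ k
... | yes _ = (0 , not b) ∷ []
... | no  _ = (suc (suc j) , b) ∷ []

ξ* : ℕ → List Letter → List Letter
ξ* k = concatMap (ξ k)

ξ^ : ℕ → ℕ → List Letter
ξ^ k zero    = (0 , false) ∷ []
ξ^ k (suc n) = ξ* k (ξ^ k n)

-- i-th letter of a word (with a dummy default value outside the word)
nth : List Letter → ℕ → Letter
nth []       i       = (0 , false)
nth (x ∷ xs) zero    = x
nth (x ∷ xs) (suc i) = nth xs i

-- The fixed point u = ξ^ω(0): since ξ(0) = 01 starts with 0, ξ^n(0) is a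
-- prefix of ξ^(n+1)(0) and |ξ^n(0)| ≥ n+1, so the i-th letter of u is the
-- i-th letter of ξ^(i+1)(0).
u : ℕ → ℕ → Letter
u k i = nth (ξ^ k (suc i)) i

Word : Set
Word = ℕ → Letter

-- The factor v[i .. i+p) of length p equals w^(p/q) with |w| = q ≥ 1,
-- i.e. it is a prefix of w^ω for the word w = v[i .. i+q); equivalently
-- it has period q.  We write q = suc d.
PowerAt : Word → (i p d : ℕ) → Set
PowerAt v i p d = ∀ j → j + suc d < p → v (i + j) ≡ v (i + j + suc d)

HasOverlap : Word → Set
HasOverlap v = ∃[ i ] ∃[ p ] ∃[ d ] (2 * suc d < p × PowerAt v i p d)

HasSquareOfPeriodAtLeast : Word → ℕ → Set
HasSquareOfPeriodAtLeast v n =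
  ∃[ i ] ∃[ d ] (n ≤ suc d × PowerAt v i (2 * suc d) d)

-- r is the exponent of a non-empty factor w^r of v with |w| ≥ n
-- (r = p/q with p = |factor| ≥ 1, q = |w| ≥ 1).
-- With n = 0 this is the set whose supremum is the critical exponent.
ExponentOf : Word → ℕ → ℚ → Set
ExponentOf v n r =
  ∃[ i ] ∃[ p ] ∃[ d ] (1 ≤ p × n ≤ suc d × PowerAt v i p d × r ≡ (+ p) / suc d)

IsSup : (ℚ → Set) → ℚ → Set
IsSup S s = (∀ r → S r → r ≤ℚ s) × (∀ b → (∀ r → S r → r ≤ℚ b) → s ≤ℚ b)

CriticalExponentIs : Word → ℚ → Set
CriticalExponentIs v e = IsSup (ExponentOf v 0) e

ConvergesTo : (ℕ → ℚ) → ℚ → Set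
ConvergesTo s e = ∀ ε → 0ℚ <ℚ ε → ∃[ N ] (∀ n → N ≤ n → ∣ s n - e ∣ <ℚ ε)

AsymptoticCriticalExponentIs : Word → ℚ → Set
AsymptoticCriticalExponentIs v e =
  ∃[ s ] ((∀ n → IsSup (ExponentOf v n) (s n)) × ConvergesTo s e)

-- For k = K + 2, applying ξ (k − 1) times turns every letter into a ramp (0, b) (1, b) ⋯ (ℓ − 1, b)
-- of a single mark b, so u is also the fixed point of this ramp substitution σ.  In u every 0 or
-- 0′ begins a ramp, so a factor that begins with 0 or 0′ and has a period whose shift again lands
-- on 0 or 0′ is a concatenation of whole ramps, and it can be desubstituted.
-- Take an overlap of least period q and slide it left until it starts with 0 or 0′.
-- Desubstituting gives a square ww of period m < q one level up, followed by a letter whose ramp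
-- has the same mark as the ramp of the first letter of w.  If w does not start with 0 or 0′, or
-- that letter is the first letter of w, then ww extends to an overlap of period m.  Otherwise it
-- is a non-zero letter with the opposite mark, which two more desubstitutions and a local
-- inspection of u rule out.  Conversely, σ maps a square of period m to one of period > m, and u
-- contains the square 0′0′, so u has arbitrarily long squares.

module Submission where

open import Defs
open import Data.Bool using (Bool; false; not)
open import Data.Bool.Properties using (not-injective; not-involutive; not-¬)
open import Data.Empty using (⊥; ⊥-elim)
open import Data.Integer using (+_; +≤+) renaming (_≤_ to _≤ℤ_)
open import Data.Integer.Properties using (pos-*)
open import Data.List using (List; []; _∷_; _++_; length; concatMap)
open import Data.List.Properties using (++-assoc; ++-identityʳ; length-++; concatMap-++)
open import Data.List.Relation.Unary.All using (All; []; _∷_)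
open import Data.List.Relation.Unary.All.Properties using (++⁺)
open import Data.Nat using (ℕ; zero; suc; _+_; _*_; _∸_; _≤_; _<_; z≤n; s≤s; _≟_; _<?_)
open import Data.Nat.Induction using (<-rec)
open import Data.Nat.Properties
open import Algebra.Properties.CommutativeSemigroup +-commutativeSemigroup using (x∙yz≈y∙xz)
open import Data.Product using (_×_; _,_; proj₁; proj₂; ∃-syntax)
open import Data.Rational using (_/_) renaming (_≤_ to _≤ℚ_)
open import Data.Rational.Properties using (toℚᵘ-cancel-≤; toℚᵘ-fromℚᵘ; fromℚᵘ-cong)
open import Data.Rational.Unnormalised using (mkℚᵘ; *≤*; *≡*) renaming (_≤_ to _≤ᵘ_)
open import Data.Rational.Unnormalised.Properties using (≤-respˡ-≃; ≤-respʳ-≃; ≃-sym)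
open import Data.Sum using (_⊎_; inj₁; inj₂)
open import Relation.Binary.Definitions using (tri<; tri≈; tri>)
open import Relation.Binary.PropositionalEquality
open import Relation.Nullary using (¬_; yes; no)

+-left-comm : ∀ m n o → m + (n + o) ≡ n + (m + o)
+-left-comm = x∙yz≈y∙xz

<⇒∃-suc-+ : ∀ {a b} → a < b → ∃[ r ] b ≡ suc r + a
<⇒∃-suc-+ {a} {b} a<b = b ∸ suc a , trans (sym (m∸n+n≡m a<b)) (+-suc (b ∸ suc a) a)

≤⇒∃-+ : ∀ {a b} → a ≤ b → ∃[ r ] b ≡ r + a
≤⇒∃-+ {a} {b} a≤b = b ∸ a , sym (m∸n+n≡m a≤b)

-- ξ^(K+1)(j, b) = (0, b′) (1, b′) ⋯ (ℓ − 1, b′) for ℓ = blockLength K (j, b) and b′ = blockBit (j, b).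
blockLength : ℕ → Letter → ℕ
blockLength K (zero , c)  = suc (suc K)
blockLength K (suc j , c) = suc j

blockBit : Letter → Bool
blockBit (zero , c)  = c
blockBit (suc j , c) = not c

blockStart : ℕ → Word → ℕ → ℕ
blockStart K v zero    = 0
blockStart K v (suc n) = blockStart K v n + blockLength K (v n)

blockLength-pos : ∀ K x → 0 < blockLength K x
blockLength-pos K (zero , c)  = s≤s z≤n
blockLength-pos K (suc j , c) = s≤s z≤n

blockLength-≤ : ∀ K x → proj₁ x < suc (suc K) → blockLength K x ≤ suc (suc K)
blockLength-≤ K (zero , c)  _   = ≤-refl
blockLength-≤ K (suc j , c) j<k = <⇒≤ j<k

blockLength-1 : ∀ K x → blockLength K x ≡ 1 → ∃[ b ] x ≡ (1 , b)
blockLength-1 K (suc zero , c) _ = c , refl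

blockCode-injective : ∀ K x y → proj₁ x < suc (suc K) → proj₁ y < suc (suc K) →
                      blockLength K x ≡ blockLength K y → blockBit x ≡ blockBit y → x ≡ y
blockCode-injective K (zero , c)  (zero , d)   _   _   _    refl = refl
blockCode-injective K (zero , c)  (suc j , d)  _   y<k refl _    = ⊥-elim (<-irrefl refl y<k)
blockCode-injective K (suc j , c) (zero , d)   x<k _   refl _    = ⊥-elim (<-irrefl refl x<k)
blockCode-injective K (suc j , c) (suc j , d)  _   _   refl b    = cong (suc j ,_) (not-injective b)

blockCode-predecessor-≢ : ∀ K j c → blockLength K (j , not c) ≡ suc (suc j) → blockBit (j , not c) ≢ c
blockCode-predecessor-≢ K zero    c _  b = not-¬ refl (sym b)
blockCode-predecessor-≢ K (suc j) c () _

HasPeriod : Word → (d S E : ℕ) → Set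
HasPeriod v d S E = ∀ p → S ≤ p → p < E → v p ≡ v (d + p)

Square : Word → (m i : ℕ) → Set
Square v m i = HasPeriod v m i (m + i)

Overlap : Word → (q i : ℕ) → Set
Overlap v q i = HasPeriod v q i (suc (q + i))

module _ {v : Word} {d : ℕ} where

  HasPeriod-empty : ∀ {S} → HasPeriod v d S S
  HasPeriod-empty p S≤p p<S = ⊥-elim (<⇒≱ p<S S≤p)

  HasPeriod-narrow : ∀ {S E S′ E′} → S ≤ S′ → E′ ≤ E → HasPeriod v d S E → HasPeriod v d S′ E′
  HasPeriod-narrow S≤S′ E′≤E h p S′≤p p<E′ = h p (≤-trans S≤S′ S′≤p) (<-≤-trans p<E′ E′≤E)

  HasPeriod-first : ∀ {S E} → S < E → HasPeriod v d S E → v S ≡ v (d + S)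
  HasPeriod-first S<E h = h _ ≤-refl S<E

  HasPeriod-extendˡ : ∀ {S E} → v S ≡ v (d + S) → HasPeriod v d (suc S) E → HasPeriod v d S E
  HasPeriod-extendˡ e h p S≤p p<E with m≤n⇒m<n∨m≡n S≤p
  ... | inj₁ S<p  = h p S<p p<E
  ... | inj₂ refl = e

  HasPeriod-extendʳ : ∀ {S E} → HasPeriod v d S E → v E ≡ v (d + E) → HasPeriod v d S (suc E)
  HasPeriod-extendʳ h e p S≤p p<1+E with m≤n⇒m<n∨m≡n (≤-pred p<1+E)
  ... | inj₁ p<E  = h p S≤p p<E
  ... | inj₂ refl = e

overlap-repeats : ∀ {v q i} → Overlap v q i → v i ≡ v (q + i) × v i ≡ v (q + (q + i))
overlap-repeats {v} {q} {i} ov = first , trans first (ov (q + i) (m≤n+m i q) (n<1+n _))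
  where
  first : v i ≡ v (q + i)
  first = HasPeriod-first (s≤s (m≤n+m i q)) ov

-- The hypothesis ramp says that v is a fixed point of σ, block n of σ(v) occupying the
-- positions from blockStart K v n on.
module RampFixedPoint (K : ℕ) (v : Word)
  (valid : ∀ n → proj₁ (v n) < suc (suc K))
  (ramp : ∀ n t → t < blockLength K (v n) → v (blockStart K v n + t) ≡ (t , blockBit (v n)))
  where

  start : ℕ → ℕ
  start = blockStart K v

  len : ℕ → ℕ
  len n = blockLength K (v n)

  bit : ℕ → Bool
  bit n = blockBit (v n)

  start-<-suc : ∀ n → start n < start (suc n)
  start-<-suc n = m<m+n (start n) (blockLength-pos K (v n))

  start-mono-< : ∀ {a b} → a < b → start a < start b
  start-mono-< {a} {suc b} (s≤s a≤b) with m≤n⇒m<n∨m≡n a≤b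
  ... | inj₁ a<b  = <-trans (start-mono-< a<b) (start-<-suc b)
  ... | inj₂ refl = start-<-suc a

  start-mono-≤ : ∀ {a b} → a ≤ b → start a ≤ start b
  start-mono-≤ a≤b with m≤n⇒m<n∨m≡n a≤b
  ... | inj₁ a<b  = <⇒≤ (start-mono-< a<b)
  ... | inj₂ refl = ≤-refl

  start-cancel-< : ∀ {a b} → start a < start b → a < b
  start-cancel-< h = ≰⇒> (λ b≤a → <⇒≱ h (start-mono-≤ b≤a))

  start-cancel-≤ : ∀ {a b} → start a ≤ start b → a ≤ b
  start-cancel-≤ h = ≮⇒≥ (λ b<a → <⇒≱ (start-mono-< b<a) h)

  start-injective : ∀ {a b} → start a ≡ start b → a ≡ b
  start-injective h = ≤-antisym (start-cancel-≤ (≤-reflexive h)) (start-cancel-≤ (≤-reflexive (sym h)))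

  letter-at-start : ∀ n → v (start n) ≡ (0 , bit n)
  letter-at-start n = trans (cong v (sym (+-identityʳ (start n)))) (ramp n 0 (blockLength-pos K (v n)))

  record Position (p : ℕ) : Set where
    constructor at
    field
      block   : ℕ
      offset  : ℕ
      offset< : offset < len block
      located : start block + offset ≡ p

  locate : ∀ p → Position p
  locate zero = at 0 0 (blockLength-pos K (v 0)) refl
  locate (suc p) with locate p
  ... | at n t t<len refl with suc t <? len n
  ... | yes t+1<len = at n (suc t) t+1<len (+-suc (start n) t)
  ... | no  t+1≮len = at (suc n) 0 (blockLength-pos K (v (suc n))) (begin
    start n + len n + 0 ≡⟨ +-identityʳ _ ⟩
    start n + len n     ≡⟨ cong (_+_ (start n)) (≤-antisym (≮⇒≥ t+1≮len) t<len) ⟩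
    start n + suc t     ≡⟨ +-suc (start n) t ⟩
    suc (start n + t)   ∎)
    where open ≡-Reasoning

  zero⇒start : ∀ {p} → proj₁ (v p) ≡ 0 → ∃[ n ] start n ≡ p
  zero⇒start {p} h with locate p
  ... | at n t t<len refl with trans (sym (cong proj₁ (ramp n t t<len))) h
  ... | refl = n , sym (+-identityʳ (start n))

  predecessor : ∀ {p j c} → v p ≡ (suc j , c) → ∃[ p₀ ] p ≡ suc p₀ × v p₀ ≡ (j , c)
  predecessor {p} {j} e with locate p
  ... | at n t t<len refl with trans (sym (ramp n t t<len)) e
  ... | refl = start n + j , +-suc (start n) j , ramp n j (<-trans (n<1+n j) t<len)

  predecessor-at : ∀ {p j c} → v (suc p) ≡ (suc j , c) → v p ≡ (j , c)
  predecessor-at e with predecessor e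
  ... | _ , refl , e₀ = e₀

  block-of-ramp : ∀ n m b → 0 < m → (∀ t → t < m → v (start n + t) ≡ (t , b)) →
                  proj₁ (v (start n + m)) ≡ 0 → len n ≡ m × bit n ≡ b
  block-of-ramp n m b 0<m h z = length≡ , cong proj₂ (trans (sym (ramp n 0 (blockLength-pos K (v n)))) (h 0 0<m))
    where
    length≡ : len n ≡ m
    length≡ with <-cmp (len n) m
    ... | tri< len<m _ _ = ⊥-elim (n>0⇒n≢0 (blockLength-pos K (v n))
            (trans (sym (cong proj₁ (h (len n) len<m))) (cong proj₁ (letter-at-start (suc n)))))
    ... | tri≈ _ len≡m _ = len≡m
    ... | tri> _ _ m<len = ⊥-elim (n>0⇒n≢0 0<m (trans (sym (cong proj₁ (ramp n m m<len))) z))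

  same-block⇒same-letter : ∀ a b → (∀ t → t ≤ len a → v (start a + t) ≡ v (start b + t)) → v a ≡ v b
  same-block⇒same-letter a b h = sym (blockCode-injective K (v b) (v a) (valid b) (valid a) (proj₁ code) (proj₂ code))
    where
    code : len b ≡ len a × bit b ≡ bit a
    code = block-of-ramp b (len a) (bit a) (blockLength-pos K (v a))
             (λ t t<len → trans (sym (h t (<⇒≤ t<len))) (ramp a t t<len))
             (trans (cong proj₁ (sym (h (len a) ≤-refl))) (cong proj₁ (letter-at-start (suc a))))

  -- A block is recognised from its ramp together with the 0 that follows it, so a period d of
  -- the letters that is aligned with block starts becomes a period e of the blocks.
  desubstitute : ∀ r {a e d S E} → start (e + a) ≡ d + start a → S ≤ start a → HasPeriod v d S E →
                 start (r + a) < E → HasPeriod v e a (r + a) × start (r + (e + a)) ≡ d + start (r + a)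
  desubstitute zero    shift _   _   _  = HasPeriod-empty , shift
  desubstitute (suc r) {a} {e} {d} shift S≤ per lt =
    HasPeriod-extendʳ (proj₁ ih) (trans same (cong v (+-left-comm r e a))) , next
    where
    open ≡-Reasoning
    ih = desubstitute r shift S≤ per (<-trans (start-<-suc (r + a)) lt)
    n = r + a
    same : v n ≡ v (r + (e + a))
    same = same-block⇒same-letter n (r + (e + a)) λ t t≤len →
      trans (per (start n + t) (≤-trans S≤ (≤-trans (start-mono-≤ (m≤n+m a r)) (m≤m+n _ t)))
                 (≤-<-trans (+-monoʳ-≤ (start n) t≤len) lt))
            (cong v (trans (sym (+-assoc d (start n) t)) (cong (_+ t) (sym (proj₂ ih)))))
    next : start (r + (e + a)) + len (r + (e + a)) ≡ d + (start n + len n)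
    next = begin
      start (r + (e + a)) + len (r + (e + a)) ≡⟨ cong₂ _+_ (proj₂ ih) (cong (blockLength K) (sym same)) ⟩
      d + start n + len n                     ≡⟨ +-assoc d (start n) (len n) ⟩
      d + (start n + len n)                   ∎

  substitute : ∀ r {a e D} → start (e + a) ≡ D + start a → HasPeriod v e a (r + a) →
               start (r + (e + a)) ≡ D + start (r + a)
  substitute zero    shift _ = shift
  substitute (suc r) {a} {e} {D} shift per = begin
    start (r + (e + a)) + len (r + (e + a)) ≡⟨ cong₂ _+_ (substitute r shift (HasPeriod-narrow ≤-refl (n≤1+n _) per))
                                                          (cong (blockLength K) (sym same)) ⟩
    D + start (r + a) + len (r + a)         ≡⟨ +-assoc D _ _ ⟩
    D + (start (r + a) + len (r + a))       ∎
    where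
    open ≡-Reasoning
    same : v (r + a) ≡ v (r + (e + a))
    same = trans (per (r + a) (m≤n+m a r) (n<1+n _)) (cong v (+-left-comm e r a))

  period-copies-ramp : ∀ {d S E a} → HasPeriod v d S E → S ≤ start a → ∀ t → t < len a → start a + t < E →
                       v (d + (start a + t)) ≡ (t , bit a)
  period-copies-ramp per S≤ t t<len <E = trans (sym (per _ (≤-trans S≤ (m≤m+n _ t)) <E)) (ramp _ t t<len)

  block-end : ∀ {n t} → t < len n → proj₁ (v (suc (start n + t))) ≡ 0 → len n ≡ suc t
  block-end {n} {t} t<len z = ≤-antisym (≮⇒≥ λ 1+t<len → 1+n≢0
    (trans (sym (cong proj₁ (ramp n (suc t) 1+t<len))) (trans (cong (λ p → proj₁ (v p)) (+-suc (start n) t)) z))) t<len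

  next-letter : ∀ {p j c} → v p ≡ (j , c) → v (suc p) ≡ (suc j , c) ⊎ ∃[ e ] v (suc p) ≡ (0 , e)
  next-letter {p} e with v (suc p) in e₁
  ... | (zero , e′) = inj₂ (e′ , refl)
  ... | (suc y , e′) with trans (sym (predecessor-at e₁)) e
  ...   | refl = inj₁ refl

  unit-block-letter : ∀ {n c} → v (start n) ≡ (0 , c) → proj₁ (v (suc (start n))) ≡ 0 → v n ≡ (1 , not c)
  unit-block-letter {n} {c} e z = blockCode-injective K (v n) (1 , not c) (valid n) (s≤s (s≤s z≤n))
                                    (proj₁ unit) (trans (proj₂ unit) (sym (not-involutive c)))
    where
    unit : len n ≡ 1 × bit n ≡ c
    unit = block-of-ramp n 1 c (s≤s z≤n)
      (λ { zero _ → trans (cong v (+-identityʳ (start n))) e ; (suc t) (s≤s ()) })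
      (trans (cong (λ p → proj₁ (v p)) (+-comm (start n) 1)) z)

  zero-zero-preceded-by-top : ∀ {p c} → v (suc p) ≡ (0 , c) → proj₁ (v (suc (suc p))) ≡ 0 → v p ≡ (suc K , not c)
  zero-zero-preceded-by-top {p} {c} e z with zero⇒start (cong proj₁ e)
  ... | n , start≡ with predecessor {n} (unit-block-letter (trans (cong v start≡) e)
                                       (trans (cong (λ q → proj₁ (v (suc q))) start≡) z))
  ... | n₀ , refl , v₀ = trans (cong v p≡) (trans (ramp n₀ (suc K) (≤-reflexive (cong (blockLength K) (sym v₀))))
                                                  (cong (suc K ,_) (cong blockBit v₀)))
    where
    open ≡-Reasoning
    p≡ : p ≡ start n₀ + suc K
    p≡ = suc-injective (begin
      suc p                       ≡⟨ sym start≡ ⟩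
      start n₀ + len n₀           ≡⟨ cong (λ x → start n₀ + blockLength K x) v₀ ⟩
      start n₀ + suc (suc K)      ≡⟨ +-suc (start n₀) (suc K) ⟩
      suc (start n₀ + suc K)      ∎)

  no-adjacent-unit-blocks : ∀ n → len n ≡ 1 → len (suc n) ≡ 1 → ⊥
  no-adjacent-unit-blocks n unit unit′ with blockLength-1 K (v n) unit | blockLength-1 K (v (suc n)) unit′
  ... | b , e | b′ , e′ with trans (sym e) (predecessor-at e′)
  ... | ()

  adjacent-blocks-long : ∀ n → 3 ≤ len n + len (suc n)
  adjacent-blocks-long n with m≤n⇒m<n∨m≡n (blockLength-pos K (v n)) | m≤n⇒m<n∨m≡n (blockLength-pos K (v (suc n)))
  ... | inj₁ 1<len | _            = +-mono-≤ 1<len (blockLength-pos K (v (suc n)))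
  ... | inj₂ _     | inj₁ 1<len′  = +-mono-≤ (blockLength-pos K (v n)) 1<len′
  ... | inj₂ 1≡len | inj₂ 1≡len′  = ⊥-elim (no-adjacent-unit-blocks n (sym 1≡len) (sym 1≡len′))

  blocks-longer-than-count : ∀ r a → start a + suc (suc r) < start (suc (suc r) + a)
  blocks-longer-than-count zero a = begin-strict
    start a + 2                       <⟨ +-monoʳ-< (start a) (adjacent-blocks-long a) ⟩
    start a + (len a + len (suc a))   ≡⟨ +-assoc (start a) (len a) (len (suc a)) ⟨
    start (2 + a)                     ∎
    where open ≤-Reasoning hiding (start)
  blocks-longer-than-count (suc r) a = begin-strict
    start a + suc (suc (suc r))    ≡⟨ +-suc (start a) (suc (suc r)) ⟩
    suc (start a + suc (suc r))    <⟨ s≤s (blocks-longer-than-count r a) ⟩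
    suc (start (suc (suc r) + a))  ≡⟨ +-comm 1 _ ⟩
    start (suc (suc r) + a) + 1    ≤⟨ +-monoʳ-≤ _ (blockLength-pos K (v (suc (suc r) + a))) ⟩
    start (suc (suc (suc r)) + a)  ∎
    where open ≤-Reasoning hiding (start)

  square-period-grows : ∀ {m I} → 0 < m → Square v m I → start I + m < start (m + I)
  square-period-grows {suc zero} {I} _ sq with m≤n⇒m<n∨m≡n (blockLength-pos K (v I))
  ... | inj₁ 1<len = +-monoʳ-< (start I) 1<len
  ... | inj₂ 1≡len = ⊥-elim (no-adjacent-unit-blocks I (sym 1≡len)
                      (trans (cong (blockLength K) (sym (HasPeriod-first (n<1+n I) sq))) (sym 1≡len)))
  square-period-grows {suc (suc r)} _ _ = blocks-longer-than-count r _

  square-lifts : ∀ {m I} → 0 < m → Square v m I → ∃[ D ] m < D × Square v D (start I)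
  square-lifts {m} {I} 0<m sq = D , m<D , lifted
    where
    D = start (m + I) ∸ start I
    D+start : D + start I ≡ start (m + I)
    D+start = m∸n+n≡m (start-mono-≤ (m≤n+m I m))
    m<D : m < D
    m<D = +-cancelʳ-< (start I) m D (subst (m + start I <_) (sym D+start)
            (subst (_< start (m + I)) (+-comm (start I) m) (square-period-grows 0<m sq)))
    lifted : Square v D (start I)
    lifted p startI≤p p<end with locate p
    ... | at n t t<len refl with ≤⇒∃-+ {I} (≤-pred (start-cancel-< (≤-<-trans startI≤p (+-monoʳ-< (start n) t<len))))
    ... | r , refl = begin
      v (start (r + I) + t)         ≡⟨ ramp (r + I) t t<len ⟩
      (t , bit (r + I))             ≡⟨ cong (λ x → (t , blockBit x)) same ⟩
      (t , bit (r + (m + I)))       ≡⟨ ramp (r + (m + I)) t (subst (t <_) (cong (blockLength K) same) t<len) ⟨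
      v (start (r + (m + I)) + t)   ≡⟨ cong (λ x → v (x + t))
                                          (substitute r (sym D+start) (HasPeriod-narrow ≤-refl (+-monoˡ-≤ I (<⇒≤ r<m)) sq)) ⟩
      v (D + start (r + I) + t)     ≡⟨ cong v (+-assoc D _ t) ⟩
      v (D + (start (r + I) + t))   ∎
      where
      open ≡-Reasoning
      r<m : r < m
      r<m = +-cancelʳ-< I r m (start-cancel-<
              (≤-<-trans (m≤m+n (start (r + I)) t) (subst (start (r + I) + t <_) D+start p<end)))
      same : v (r + I) ≡ v (r + (m + I))
      same = trans (sq (r + I) (m≤n+m I r) (+-monoˡ-< I r<m)) (cong v (+-left-comm m r I))

  -- In the next three lemmas HasPeriod v (suc m) I (m + I) says that v reads x a x b from
  -- position I on, where x = v[I, m + I), a = v (m + I) and b = v (m + (suc m + I)).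
  echo-flip-after-long-block : ∀ {s I j c} → HasPeriod v (suc s) I (s + I) → bit I ≡ c →
    len (s + I) ≡ suc (suc j) → bit (s + I) ≡ c → v (s + (suc s + I)) ≡ (suc j , not c) → ⊥
  echo-flip-after-long-block {zero} {I} {j} {c} _ _ lenB bitB flip =
    blockCode-predecessor-≢ K j c (trans (cong (blockLength K) (sym before)) lenB) (trans (cong blockBit (sym before)) bitB)
    where
    before : v I ≡ (j , not c)
    before = predecessor-at flip
  echo-flip-after-long-block {suc s} {I} {j} {c} echo bitI lenB bitB flip
    with trans (echo (s + I) (m≤n+m I s) (n<1+n _)) (trans (cong v (+-left-comm (suc (suc s)) s I)) (predecessor-at flip))
  ... | before with next-letter before
  ...   | inj₁ vB = 1+n≢n (trans (sym lenB) (cong (blockLength K) vB))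
  ...   | inj₂ (e , vB) with next-letter vB
  ...     | inj₁ vJ =
    not-¬ e≡c (trans (sym (not-involutive e)) (cong not (trans (sym (cong blockBit (trans echoI vJ))) bitI)))
    where
    echoI : v I ≡ v (suc (suc s) + I)
    echoI = HasPeriod-first (s≤s (m≤n+m I s)) echo
    e≡c : e ≡ c
    e≡c = trans (sym (cong blockBit vB)) bitB
  ...     | inj₂ (_ , vJ) = 1+n≢n (sym (trans K≡j j≡1+K))
    where
    K≡j : K ≡ j
    K≡j = suc-injective (suc-injective (trans (sym (cong (blockLength K) vB)) lenB))
    j≡1+K : j ≡ suc K
    j≡1+K = cong proj₁ (trans (sym before) (zero-zero-preceded-by-top vB (cong proj₁ vJ)))

  echo-flip-from-zero : ∀ {m I j c} → HasPeriod v (suc m) I (m + I) → v I ≡ (0 , c) → v (suc m + I) ≡ (0 , c) →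
                        v (m + I) ≡ (suc j , c) → v (m + (suc m + I)) ≡ (0 , not c) → ⊥
  echo-flip-from-zero {m} {I} {j} {c} echo vI vJ va vb with locate (m + I) | zero⇒start (cong proj₁ vI)
  ... | at B t t<len located | I₂ , refl with trans (sym (ramp B t t<len)) (trans (cong v located) va)
  ... | refl with ≤⇒∃-+ {I₂} {B} (≤-pred (start-cancel-<
                    (≤-<-trans (≤-trans (m≤n+m _ m) (≤-reflexive (sym located))) (+-monoʳ-< (start B) t<len))))
  ... | s , refl = echo-flip-after-long-block (proj₁ D) bitI₂ lenB refl flip
    where
    open ≡-Reasoning
    b₂ = s + (suc s + I₂)
    bitI₂ : bit I₂ ≡ bit B
    bitI₂ = cong proj₂ (trans (sym (letter-at-start I₂)) vI)
    lenB : len B ≡ suc (suc j)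
    lenB = block-end t<len (trans (cong (λ p → proj₁ (v (suc p))) located) (cong proj₁ vJ))
    shift : start (suc s + I₂) ≡ suc m + start I₂
    shift = begin
      start B + len B         ≡⟨ cong (_+_ (start B)) lenB ⟩
      start B + suc (suc j)   ≡⟨ +-suc (start B) (suc j) ⟩
      suc (start B + suc j)   ≡⟨ cong suc located ⟩
      suc m + start I₂        ∎
    D = desubstitute s shift ≤-refl echo (subst (start B <_) located (m<m+n (start B) (s≤s z≤n)))
    copy : ∀ t → t < suc j → v (start b₂ + t) ≡ (t , bit B)
    copy t t<j = trans (cong v (trans (cong (_+ t) (proj₂ D)) (+-assoc (suc m) (start B) t)))
                   (period-copies-ramp echo (start-mono-≤ (m≤n+m I₂ s)) t (<-trans t<j t<len)
                     (subst (start B + t <_) located (+-monoʳ-< (start B) t<j)))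
    end : proj₁ (v (start b₂ + suc j)) ≡ 0
    end = cong proj₁ (trans (cong v (begin
      start b₂ + suc j                ≡⟨ cong (_+ suc j) (proj₂ D) ⟩
      suc m + start B + suc j         ≡⟨ +-assoc (suc m) (start B) (suc j) ⟩
      suc m + (start B + suc j)       ≡⟨ cong (_+_ (suc m)) located ⟩
      suc m + (m + start I₂)          ≡⟨ +-left-comm (suc m) m (start I₂) ⟩
      m + (suc m + start I₂)          ∎)) vb)
    flip : v b₂ ≡ (suc j , not (bit B))
    flip = blockCode-injective K (v b₂) (suc j , not (bit B)) (valid b₂)
             (subst (_≤ suc (suc K)) lenB (blockLength-≤ K (v B) (valid B)))
             (proj₁ ramp₂) (trans (proj₂ ramp₂) (sym (not-involutive _)))
      where
      ramp₂ = block-of-ramp b₂ (suc j) (bit B) (s≤s z≤n) copy end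

  echo-flip-into-long-block : ∀ {m I j c} → HasPeriod v (suc m) I (m + I) → bit I ≡ c → v (m + I) ≡ (suc j , c) →
    bit (m + (suc m + I)) ≡ not c → suc j < len (m + (suc m + I)) → ⊥
  echo-flip-into-long-block {zero} _ bitI va _ _ = not-¬ refl (trans (sym bitI) (cong blockBit va))
  echo-flip-into-long-block {suc m} {I} {j} {c} echo bitI va bitb longb
    with next-letter (trans (sym (trans (echo (m + I) (m≤n+m I m) (n<1+n _)) (cong v (+-left-comm (suc (suc m)) m I))))
                            (predecessor-at va))
       | next-letter va
  ... | inj₁ vb       | _             = <-irrefl (sym (cong (blockLength K) vb)) longb
  ... | inj₂ _        | inj₁ vJ       =
    not-¬ refl (trans (sym bitI) (cong blockBit (trans (HasPeriod-first (s≤s (m≤n+m I m)) echo) vJ)))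
  ... | inj₂ (_ , vb) | inj₂ (_ , vJ) = echo-flip-from-zero echo vI (trans (sym echoI) vI) va
                                          (trans vb (cong (zero ,_) (trans (sym (cong blockBit vb)) bitb)))
    where
    echoI : v I ≡ v (suc (suc m) + I)
    echoI = HasPeriod-first (s≤s (m≤n+m I m)) echo
    vI : v I ≡ (0 , c)
    vI = trans (trans echoI vJ) (cong (zero ,_) (trans (sym (cong blockBit (trans echoI vJ))) bitI))

  square-then-flip-impossible : ∀ {q i c j} → 0 < q → Square v q i → v i ≡ (0 , c) →
                                v (q + (q + i)) ≡ (suc j , not c) → ⊥
  square-then-flip-impossible {q} {i} {c} {j} 0<q sq vi flip with zero⇒start (cong proj₁ vi)
  ... | I , refl with zero⇒start (cong proj₁ (trans (sym (HasPeriod-first (m<n+m _ 0<q) sq)) vi))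
  ... | J , startJ with <⇒∃-suc-+ {I} {J} (start-cancel-< (subst (start I <_) (sym startJ) (m<n+m (start I) 0<q)))
  ... | m , refl = echo-flip-into-long-block (proj₁ D) bitI va bitb (subst (_< len b) lena lena<lenb)
    where
    D = desubstitute m startJ ≤-refl sq (subst (start (m + I) <_) startJ (start-<-suc (m + I)))
    a = m + I
    b = m + (suc m + I)
    copy : ∀ t → t < len a → v (start b + t) ≡ (t , bit a)
    copy t t<len = trans (cong v (trans (cong (_+ t) (proj₂ D)) (+-assoc q (start a) t)))
                     (period-copies-ramp sq (start-mono-≤ (m≤n+m I m)) t t<len
                       (subst (start a + t <_) startJ (+-monoʳ-< (start a) t<len)))
    after : v (start b + len a) ≡ (suc j , not c)
    after = trans (cong v (trans (cong (_+ len a) (proj₂ D)) (trans (+-assoc q (start a) (len a)) (cong (_+_ q) startJ)))) flip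
    b-outlasts-a : ¬ (len b ≤ len a)
    b-outlasts-a lenb≤lena with m≤n⇒m<n∨m≡n lenb≤lena
    ... | inj₁ lenb<lena = n>0⇒n≢0 (blockLength-pos K (v b))
            (trans (sym (cong proj₁ (copy (len b) lenb<lena))) (cong proj₁ (letter-at-start (suc b))))
    ... | inj₂ lenb≡lena = 1+n≢0 (trans (sym (cong proj₁ after))
            (trans (cong (λ n → proj₁ (v (start b + n))) (sym lenb≡lena)) (cong proj₁ (letter-at-start (suc b)))))
    lena<lenb : len a < len b
    lena<lenb = ≰⇒> b-outlasts-a
    letter : (len a , bit b) ≡ (suc j , not c)
    letter = trans (sym (ramp b (len a) lena<lenb)) after
    lena : len a ≡ suc j
    lena = cong proj₁ letter
    bitb : bit b ≡ not c
    bitb = cong proj₂ letter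
    bita≡bitb : bit a ≡ bit b
    bita≡bitb = cong proj₂ (trans (sym (copy 0 (blockLength-pos K (v a))))
                                  (trans (cong v (+-identityʳ _)) (letter-at-start b)))
    va : v a ≡ (suc j , c)
    va = blockCode-injective K (v a) (suc j , c) (valid a) (subst (_< suc (suc K)) (cong proj₁ after) (valid _))
           lena (trans bita≡bitb bitb)
    bitI : bit I ≡ c
    bitI = cong proj₂ (trans (sym (letter-at-start I)) vi)

  period-shiftˡ : ∀ {d i E j c} → suc i < E → HasPeriod v d (suc i) E → v (suc i) ≡ (suc j , c) → HasPeriod v d i E
  period-shiftˡ {d} {i} {E} {j} {c} i<E per e = HasPeriod-extendˡ (trans (predecessor-at e) (sym (predecessor-at shifted))) per
    where
    shifted : v (suc (d + i)) ≡ (suc j , c)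
    shifted = trans (cong v (sym (+-suc d i))) (trans (sym (HasPeriod-first i<E per)) e)

  overlap-from-zero : ∀ j {q i c} → v i ≡ (j , c) → Overlap v q i →
                      ∃[ i₀ ] ∃[ c₀ ] Overlap v q i₀ × v i₀ ≡ (0 , c₀)
  overlap-from-zero zero    e ov = _ , _ , ov , e
  overlap-from-zero (suc j) {q} {i} e ov with predecessor {i} e
  ... | i₀ , refl , e₀ = overlap-from-zero j e₀
          (HasPeriod-narrow ≤-refl (s≤s (+-monoʳ-≤ q (n≤1+n i₀))) (period-shiftˡ (s≤s (m≤n+m _ q)) ov e))

  overlap-desubstitutes : ∀ {q i c} → 0 < q → Overlap v q i → v i ≡ (0 , c) →
    ∃[ I ] ∃[ m ] 0 < m × m < q × Square v m I × bit (m + (m + I)) ≡ bit I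
  overlap-desubstitutes {q} {i} {c} 0<q ov e with zero⇒start (cong proj₁ e)
  ... | I , refl with zero⇒start (cong proj₁ (trans (sym (proj₁ (overlap-repeats ov))) e))
  ... | J , startJ with <⇒∃-suc-+ {I} {J} (start-cancel-< (subst (start I <_) (sym startJ) (m<n+m (start I) 0<q)))
  ... | r , refl with zero⇒start (cong proj₁ (trans (sym (proj₂ (overlap-repeats ov))) e))
  ... | L , startL = I , suc r , s≤s z≤n , m<q , proj₁ D , bits
    where
    m = suc r
    D = desubstitute m startJ ≤-refl ov (s≤s (≤-reflexive startJ))
    L≡ : L ≡ m + (m + I)
    L≡ = start-injective (trans startL (sym (trans (proj₂ D) (cong (_+_ q) startJ))))
    bits : bit (m + (m + I)) ≡ bit I
    bits = trans (cong bit (sym L≡))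
             (cong proj₂ (trans (sym (letter-at-start L)) (trans (cong v startL)
                                  (trans (sym (proj₂ (overlap-repeats ov))) (letter-at-start I)))))
    m<q : m < q
    m<q = +-cancelˡ-< (start I) m q
            (subst (start I + m <_) (trans startJ (+-comm q (start I))) (square-period-grows (s≤s z≤n) (proj₁ D)))

  square-with-equal-end-bits : ∀ {m I} → 0 < m → Square v m I → bit (m + (m + I)) ≡ bit I → ∃[ i ] Overlap v m i
  square-with-equal-end-bits {m} {I} 0<m sq bits with v I in eI
  ... | (suc j , c) with predecessor {I} eI
  ...   | I₀ , refl , _ = I₀ , subst (HasPeriod v m I₀) (+-suc m I₀) (period-shiftˡ (m<n+m (suc I₀) 0<m) sq eI)
  square-with-equal-end-bits {m} {I} 0<m sq bits | (zero , c) with v (m + (m + I)) in eE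
  ... | (zero , c′) = I , HasPeriod-extendʳ sq
                            (trans (sym (HasPeriod-first (m<n+m I 0<m) sq)) (trans eI (trans (cong (zero ,_) (sym bits)) (sym eE))))
  ... | (suc j , e) = ⊥-elim (square-then-flip-impossible 0<m sq eI
                               (trans eE (cong (suc j ,_) (trans (sym (not-involutive e)) (cong not bits)))))

  no-overlap : ∀ q {i} → 0 < q → ¬ Overlap v q i
  no-overlap = <-rec (λ q → ∀ {i} → 0 < q → ¬ Overlap v q i) step
    where
    step : ∀ q → (∀ {m} → m < q → ∀ {i} → 0 < m → ¬ Overlap v m i) → ∀ {i} → 0 < q → ¬ Overlap v q i
    step q smaller {i} 0<q ov with overlap-from-zero (proj₁ (v i)) refl ov
    ... | _ , _ , ov₀ , e₀ with overlap-desubstitutes 0<q ov₀ e₀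
    ... | _ , _ , 0<m , m<q , sq , bits with square-with-equal-end-bits 0<m sq bits
    ... | _ , ov₁ = smaller m<q 0<m ov₁

  squares-unbounded : ∀ {m I} → 0 < m → Square v m I → ∀ n → ∃[ I′ ] ∃[ d ] n ≤ suc d × Square v (suc d) I′
  squares-unbounded {suc d} {I} _ sq zero = I , d , z≤n , sq
  squares-unbounded 0<m sq (suc n) with squares-unbounded 0<m sq n
  ... | I′ , d , n≤ , sq′ with square-lifts (s≤s z≤n) sq′
  ...   | suc D , 1+d<D , lifted = start I′ , D , ≤-trans (s≤s n≤) 1+d<D , lifted

nth-++ˡ : ∀ A B i → i < length A → nth (A ++ B) i ≡ nth A i
nth-++ˡ (x ∷ A) B zero    _          = refl
nth-++ˡ (x ∷ A) B (suc i) (s≤s i<A) = nth-++ˡ A B i i<A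

nth-++ʳ : ∀ A B i → nth (A ++ B) (length A + i) ≡ nth B i
nth-++ʳ []      B i = refl
nth-++ʳ (x ∷ A) B i = nth-++ʳ A B i

blockStart-cong : ∀ K {w w′} n → (∀ i → i < n → w i ≡ w′ i) → blockStart K w n ≡ blockStart K w′ n
blockStart-cong K zero    _  = refl
blockStart-cong K (suc n) eq = cong₂ _+_ (blockStart-cong K n (λ i i<n → eq i (<-trans i<n (n<1+n n))))
                                         (cong (blockLength K) (eq n (n<1+n n)))

blockStart-cons : ∀ K x A n → blockStart K (nth (x ∷ A)) (suc n) ≡ blockLength K x + blockStart K (nth A) n
blockStart-cons K x A zero    = sym (+-identityʳ (blockLength K x))
blockStart-cons K x A (suc n) = trans (cong (_+ blockLength K (nth A n)) (blockStart-cons K x A n))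
                                      (+-assoc (blockLength K x) _ _)

module XiFixedPoint (K : ℕ) where

  k : ℕ
  k = suc (suc K)

  Valid : Letter → Set
  Valid x = proj₁ x < k

  ascent : Bool → ℕ → ℕ → List Letter
  ascent b a zero    = []
  ascent b a (suc n) = (a , b) ∷ ascent b (suc a) n

  block : Letter → List Letter
  block x = ascent (blockBit x) 0 (blockLength K x)

  length-ascent : ∀ b a n → length (ascent b a n) ≡ n
  length-ascent b a zero    = refl
  length-ascent b a (suc n) = cong suc (length-ascent b (suc a) n)

  nth-ascent : ∀ b a n t → t < n → nth (ascent b a n) t ≡ (a + t , b)
  nth-ascent b a (suc n) zero    _         = cong (_, b) (sym (+-identityʳ a))
  nth-ascent b a (suc n) (suc t) (s≤s t<n) = trans (nth-ascent b (suc a) n t t<n) (cong (_, b) (sym (+-suc a t)))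

  ξ-climb : ∀ j b → suc (suc j) ≢ k → ξ k (suc j , b) ≡ (suc (suc j) , b) ∷ []
  ξ-climb j b ≢k with suc (suc j) ≟ k
  ... | yes ≡k = ⊥-elim (≢k ≡k)
  ... | no  _  = refl

  ξ-wrap : ∀ j b → suc (suc j) ≡ k → ξ k (suc j , b) ≡ (0 , not b) ∷ []
  ξ-wrap j b ≡k with suc (suc j) ≟ k
  ... | yes _   = refl
  ... | no  ≢k  = ⊥-elim (≢k ≡k)

  ξ-nonempty : ∀ x → 0 < length (ξ k x)
  ξ-nonempty (zero , b) = s≤s z≤n
  ξ-nonempty (suc j , b) with suc (suc j) ≟ k
  ... | yes _ = s≤s z≤n
  ... | no  _ = s≤s z≤n

  ξ-valid : ∀ x → Valid x → All Valid (ξ k x)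
  ξ-valid (zero , b)  _   = s≤s z≤n ∷ s≤s (s≤s z≤n) ∷ []
  ξ-valid (suc j , b) j<k with suc (suc j) ≟ k
  ... | yes _  = s≤s z≤n ∷ []
  ... | no  ≢k = ≤∧≢⇒< j<k ≢k ∷ []

  ξ*-valid : ∀ A → All Valid A → All Valid (ξ* k A)
  ξ*-valid []      []        = []
  ξ*-valid (x ∷ A) (vx ∷ vA) = ++⁺ (ξ-valid x vx) (ξ*-valid A vA)

  length-ξ* : ∀ A → length A ≤ length (ξ* k A)
  length-ξ* []      = z≤n
  length-ξ* (x ∷ A) = subst (suc (length A) ≤_) (sym (length-++ (ξ k x))) (+-mono-≤ (ξ-nonempty x) (length-ξ* A))

  ξ*-ascent : ∀ b a n → suc (a + n) < k → ξ* k (ascent b (suc a) n) ≡ ascent b (suc (suc a)) n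
  ξ*-ascent b a zero    _ = refl
  ξ*-ascent b a (suc n) lt = cong₂ _++_
    (ξ-climb a b (<⇒≢ (≤-<-trans (s≤s (subst (suc a ≤_) (sym (+-suc a n)) (s≤s (m≤m+n a n)))) lt)))
    (ξ*-ascent b (suc a) n (subst (λ m → suc m < k) (+-suc a n) lt))

  ξ*^ : ℕ → List Letter → List Letter
  ξ*^ zero    A = A
  ξ*^ (suc t) A = ξ* k (ξ*^ t A)

  ξ*^-++ : ∀ t A B → ξ*^ t (A ++ B) ≡ ξ*^ t A ++ ξ*^ t B
  ξ*^-++ zero    A B = refl
  ξ*^-++ (suc t) A B = trans (cong (ξ* k) (ξ*^-++ t A B)) (concatMap-++ (ξ k) (ξ*^ t A) (ξ*^ t B))

  ξ*^-+ : ∀ s t A → ξ*^ (s + t) A ≡ ξ*^ s (ξ*^ t A)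
  ξ*^-+ zero    t A = refl
  ξ*^-+ (suc s) t A = cong (ξ* k) (ξ*^-+ s t A)

  ξ*^-[] : ∀ t → ξ*^ t [] ≡ []
  ξ*^-[] zero    = refl
  ξ*^-[] (suc t) = cong (ξ* k) (ξ*^-[] t)

  ξ^≡ξ*^ : ∀ n → ξ^ k n ≡ ξ*^ n ((0 , false) ∷ [])
  ξ^≡ξ*^ zero    = refl
  ξ^≡ξ*^ (suc n) = cong (ξ* k) (ξ^≡ξ*^ n)

  ξ*^-zero : ∀ t b → t < k → ξ*^ t ((0 , b) ∷ []) ≡ ascent b 0 (suc t)
  ξ*^-zero zero    b _  = refl
  ξ*^-zero (suc t) b lt = trans (cong (ξ* k) (ξ*^-zero t b (<-trans (n<1+n t) lt)))
                                (cong (λ A → (0 , b) ∷ (1 , b) ∷ A) (ξ*-ascent b 0 t lt))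

  ξ*^-climb : ∀ t j b → suc j + t < k → ξ*^ t ((suc j , b) ∷ []) ≡ (suc j + t , b) ∷ []
  ξ*^-climb zero    j b _  = cong (λ i → (i , b) ∷ []) (sym (+-identityʳ (suc j)))
  ξ*^-climb (suc t) j b lt = begin
    ξ* k (ξ*^ t ((suc j , b) ∷ []))   ≡⟨ cong (ξ* k) (ξ*^-climb t j b (<-trans (+-monoʳ-< (suc j) (n<1+n t)) lt)) ⟩
    ξ k (suc (j + t) , b) ++ []       ≡⟨ ++-identityʳ _ ⟩
    ξ k (suc (j + t) , b)             ≡⟨ ξ-climb (j + t) b (<⇒≢ (subst (_< k) (cong suc (+-suc j t)) lt)) ⟩
    (suc (suc (j + t)) , b) ∷ []      ≡⟨ cong (λ i → (suc i , b) ∷ []) (+-suc j t) ⟨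
    (suc j + suc t , b) ∷ []          ∎
    where open ≡-Reasoning

  ξ*^-block : ∀ x → Valid x → ξ*^ (suc K) (x ∷ []) ≡ block x
  ξ*^-block (zero , b)  _   = ξ*^-zero (suc K) b ≤-refl
  ξ*^-block (suc j , b) j<k = begin
    ξ*^ (suc K) ((suc j , b) ∷ [])             ≡⟨ cong (λ t → ξ*^ t ((suc j , b) ∷ [])) 1+K≡ ⟩
    ξ*^ (j + suc r) ((suc j , b) ∷ [])         ≡⟨ ξ*^-+ j (suc r) _ ⟩
    ξ*^ j (ξ* k (ξ*^ r ((suc j , b) ∷ [])))    ≡⟨ cong (λ A → ξ*^ j (ξ* k A))
                                                     (ξ*^-climb r j b (subst (λ i → suc i < k) (sym j+r≡K) ≤-refl)) ⟩
    ξ*^ j (ξ k (suc (j + r) , b) ++ [])        ≡⟨ cong (ξ*^ j) (trans (++-identityʳ _)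
                                                     (ξ-wrap (j + r) b (cong (λ i → suc (suc i)) j+r≡K))) ⟩
    ξ*^ j ((0 , not b) ∷ [])                   ≡⟨ ξ*^-zero j (not b) (<-trans (n<1+n j) j<k) ⟩
    ascent (not b) 0 (suc j)                   ∎
    where
    open ≡-Reasoning
    r = K ∸ j
    j+r≡K : j + r ≡ K
    j+r≡K = m+[n∸m]≡n (≤-pred (≤-pred j<k))
    1+K≡ : suc K ≡ j + suc r
    1+K≡ = trans (cong suc (sym j+r≡K)) (sym (+-suc j r))

  ξ*^-blocks : ∀ A → All Valid A → ξ*^ (suc K) A ≡ concatMap block A
  ξ*^-blocks []      _         = ξ*^-[] (suc K)
  ξ*^-blocks (x ∷ A) (vx ∷ vA) = trans (ξ*^-++ (suc K) (x ∷ []) A) (cong₂ _++_ (ξ*^-block x vx) (ξ*^-blocks A vA))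

  nth-blocks : ∀ A n t → n < length A → t < blockLength K (nth A n) →
               nth (concatMap block A) (blockStart K (nth A) n + t) ≡ (t , blockBit (nth A n))
               × blockStart K (nth A) n + t < length (concatMap block A)
  nth-blocks (x ∷ A) zero t _ t<len =
    trans (nth-++ˡ (block x) _ t t<block) (nth-ascent _ 0 _ t t<len) ,
    subst (t <_) (sym (length-++ (block x))) (≤-trans t<block (m≤m+n _ _))
    where
    t<block : t < length (block x)
    t<block = subst (t <_) (sym (length-ascent _ 0 _)) t<len
  nth-blocks (x ∷ A) (suc n) t (s≤s n<A) t<len with nth-blocks A n t n<A t<len
  ... | letter , bound =
    trans (cong (nth (block x ++ concatMap block A)) shift) (trans (nth-++ʳ (block x) _ _) letter) ,
    subst (_< length (block x ++ concatMap block A)) (sym shift)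
      (subst (length (block x) + (blockStart K (nth A) n + t) <_) (sym (length-++ (block x))) (+-monoʳ-< _ bound))
    where
    shift : blockStart K (nth (x ∷ A)) (suc n) + t ≡ length (block x) + (blockStart K (nth A) n + t)
    shift = trans (cong (_+ t) (trans (blockStart-cons K x A n)
                                      (cong (_+ blockStart K (nth A) n) (sym (length-ascent (blockBit x) 0 (blockLength K x))))))
                  (+-assoc (length (block x)) (blockStart K (nth A) n) t)

  ξ^-grows : ∀ n → ∃[ R ] 0 < length R × ξ^ k (suc n) ≡ ξ^ k n ++ R
  ξ^-grows zero = (1 , false) ∷ [] , s≤s z≤n , refl
  ξ^-grows (suc n) with ξ^-grows n
  ... | R , 0<R , grow = ξ* k R , ≤-trans 0<R (length-ξ* R) ,
                         trans (cong (ξ* k) grow) (concatMap-++ (ξ k) (ξ^ k n) R)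

  ξ^-prefix : ∀ r n → ∃[ R ] ξ^ k (r + n) ≡ ξ^ k n ++ R
  ξ^-prefix zero    n = [] , sym (++-identityʳ _)
  ξ^-prefix (suc r) n with ξ^-prefix r n | ξ^-grows (r + n)
  ... | R , e | R′ , _ , e′ = R ++ R′ , trans e′ (trans (cong (_++ R′) e) (++-assoc (ξ^ k n) R R′))

  length-ξ^ : ∀ n → n < length (ξ^ k n)
  length-ξ^ zero    = s≤s z≤n
  length-ξ^ (suc n) with ξ^-grows n
  ... | R , 0<R , grow = subst (suc (suc n) ≤_) (sym (trans (cong length grow) (length-++ (ξ^ k n))))
                           (subst (_≤ length (ξ^ k n) + length R) (+-comm (suc n) 1) (+-mono-≤ (length-ξ^ n) 0<R))

  nth-stable : ∀ r n i → i < length (ξ^ k n) → nth (ξ^ k (r + n)) i ≡ nth (ξ^ k n) i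
  nth-stable r n i i<len with ξ^-prefix r n
  ... | R , e = trans (cong (λ w → nth w i) e) (nth-++ˡ (ξ^ k n) R i i<len)

  u-nth : ∀ N i → i < length (ξ^ k N) → u k i ≡ nth (ξ^ k N) i
  u-nth N i i<len = begin
    nth (ξ^ k (suc i)) i       ≡⟨ nth-stable N (suc i) i (<-trans (n<1+n i) (length-ξ^ (suc i))) ⟨
    nth (ξ^ k (N + suc i)) i   ≡⟨ cong (λ n → nth (ξ^ k n) i) (+-comm N (suc i)) ⟩
    nth (ξ^ k (suc i + N)) i   ≡⟨ nth-stable (suc i) N i i<len ⟩
    nth (ξ^ k N) i             ∎
    where open ≡-Reasoning

  ξ^-valid : ∀ n → All Valid (ξ^ k n)
  ξ^-valid zero    = s≤s z≤n ∷ []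
  ξ^-valid (suc n) = ξ*-valid _ (ξ^-valid n)

  nth-valid : ∀ A i → All Valid A → Valid (nth A i)
  nth-valid []      i       _        = s≤s z≤n
  nth-valid (x ∷ A) zero    (vx ∷ _) = vx
  nth-valid (x ∷ A) (suc i) (_ ∷ vA) = nth-valid A i vA

  u-valid : ∀ n → Valid (u k n)
  u-valid n = nth-valid (ξ^ k (suc n)) n (ξ^-valid (suc n))

  u-ramp : ∀ n t → t < blockLength K (u k n) → u k (blockStart K (u k) n + t) ≡ (t , blockBit (u k n))
  u-ramp n t t<len = begin
    u k P                                                 ≡⟨ u-nth (suc K + suc n) P bound ⟩
    nth (ξ^ k (suc K + suc n)) P                          ≡⟨ cong (λ w → nth w P) blocks ⟩
    nth (concatMap block A) P                             ≡⟨ cong (λ s → nth (concatMap block A) (s + t)) starts ⟨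
    nth (concatMap block A) (blockStart K (nth A) n + t)  ≡⟨ proj₁ inBlock ⟩
    (t , blockBit (nth A n))                              ≡⟨ cong (λ x → (t , blockBit x)) (u-nth (suc n) n n<A) ⟨
    (t , blockBit (u k n))                                ∎
    where
    open ≡-Reasoning
    A = ξ^ k (suc n)
    P = blockStart K (u k) n + t
    n<A : n < length A
    n<A = <-trans (n<1+n n) (length-ξ^ (suc n))
    starts : blockStart K (nth A) n ≡ blockStart K (u k) n
    starts = blockStart-cong K n (λ i i<n → sym (u-nth (suc n) i (<-trans i<n n<A)))
    blocks : ξ^ k (suc K + suc n) ≡ concatMap block A
    blocks = trans (ξ^≡ξ*^ (suc K + suc n)) (trans (ξ*^-+ (suc K) (suc n) _)
               (trans (cong (ξ*^ (suc K)) (sym (ξ^≡ξ*^ (suc n)))) (ξ*^-blocks A (ξ^-valid (suc n)))))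
    inBlock = nth-blocks A n t n<A (subst (t <_) (cong (blockLength K) (u-nth (suc n) n n<A)) t<len)
    bound : P < length (ξ^ k (suc K + suc n))
    bound = subst (λ w → P < length w) (sym blocks)
              (subst (λ s → s + t < length (concatMap block A)) starts (proj₂ inBlock))

HasOverlap⇒Overlap : ∀ {v} → HasOverlap v → ∃[ q ] ∃[ i ] 0 < q × Overlap v q i
HasOverlap⇒Overlap {v} (i , p , d , 2q<p , pw) = suc d , i , s≤s z≤n , periodic
  where
  periodic : Overlap v (suc d) i
  periodic P i≤P P<end with ≤⇒∃-+ {i} i≤P
  ... | j , refl = trans (cong v (+-comm j i))
                     (trans (pw j j+q<p) (cong v (trans (+-comm (i + j) (suc d)) (cong (_+_ (suc d)) (+-comm i j)))))
    where
    j+q<p : j + suc d < p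
    j+q<p = ≤-<-trans (+-monoˡ-≤ (suc d) (+-cancelʳ-≤ i j (suc d) (≤-pred P<end)))
                      (subst (_< p) (cong (_+_ (suc d)) (+-identityʳ (suc d))) 2q<p)

Square⇒PowerAt : ∀ {v d i} → Square v (suc d) i → PowerAt v i (2 * suc d) d
Square⇒PowerAt {v} {d} {i} sq j j+q<2q =
  trans (sq (i + j) (m≤m+n i j) (subst (i + j <_) (+-comm i (suc d)) (+-monoʳ-< i j<q))) (cong v (+-comm (suc d) (i + j)))
  where
  j<q : j < suc d
  j<q = +-cancelʳ-< (suc d) j (suc d) (subst (j + suc d <_) (cong (_+_ (suc d)) (+-identityʳ (suc d))) j+q<2q)

p/[1+d]≤2 : ∀ p d → p ≤ 2 * suc d → (+ p) / suc d ≤ℚ (+ 2) / 1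
p/[1+d]≤2 p d p≤2q = toℚᵘ-cancel-≤ (≤-respˡ-≃ (≃-sym (toℚᵘ-fromℚᵘ (mkℚᵘ (+ p) d)))
                       (≤-respʳ-≃ (≃-sym (toℚᵘ-fromℚᵘ (mkℚᵘ (+ 2) 0))) unnormalised))
  where
  unnormalised : mkℚᵘ (+ p) d ≤ᵘ mkℚᵘ (+ 2) 0
  unnormalised = *≤* (subst₂ _≤ℤ_ (pos-* p 1) (pos-* 2 (suc d))
                       (+≤+ (subst (_≤ 2 * suc d) (sym (*-identityʳ p)) p≤2q)))

2[1+d]/[1+d]≡2 : ∀ d → (+ (2 * suc d)) / suc d ≡ (+ 2) / 1
2[1+d]/[1+d]≡2 d = fromℚᵘ-cong {mkℚᵘ (+ (2 * suc d)) d} {mkℚᵘ (+ 2) 0}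
  (*≡* (trans (sym (pos-* (2 * suc d) 1)) (trans (cong +_ (*-identityʳ (2 * suc d))) (pos-* 2 (suc d)))))

exponents-sup-2 : ∀ {v} → ¬ HasOverlap v → (∀ n → HasSquareOfPeriodAtLeast v n) →
                  ∀ n → IsSup (ExponentOf v n) ((+ 2) / 1)
exponents-sup-2 {v} overlap-free squares n = upper , least
  where
  upper : ∀ r → ExponentOf v n r → r ≤ℚ (+ 2) / 1
  upper _ (i , p , d , _ , _ , pw , refl) = p/[1+d]≤2 p d (≮⇒≥ λ 2q<p → overlap-free (i , p , d , 2q<p , pw))
  least : ∀ b → (∀ r → ExponentOf v n r → r ≤ℚ b) → (+ 2) / 1 ≤ℚ b
  least b bound with squares n
  ... | i , d , n≤q , pw =
    subst (_≤ℚ b) (2[1+d]/[1+d]≡2 d) (bound _ (i , 2 * suc d , d , s≤s z≤n , n≤q , pw , refl))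

proposition2 : (k : ℕ) → 4 ≤ k →
    ¬ HasOverlap (u k)
    × (∀ n → HasSquareOfPeriodAtLeast (u k) n)
    × CriticalExponentIs (u k) ((+ 2) / 1)
    × AsymptoticCriticalExponentIs (u k) ((+ 2) / 1)
proposition2 (suc (suc (suc K))) (s≤s (s≤s (s≤s _))) =
  overlap-free , squares , exponents 0 , (λ _ → (+ 2) / 1) , exponents , λ _ ε>0 → 0 , λ _ _ → ε>0
  where
  open XiFixedPoint (suc K) using (u-valid; u-ramp)
  open RampFixedPoint (suc K) (u (3 + K)) u-valid u-ramp
  square-0′0′ : Square (u (3 + K)) 1 (3 + K)
  square-0′0′ = HasPeriod-extendʳ {u (3 + K)} {1} {3 + K} (HasPeriod-empty {u (3 + K)} {1})
                  (trans (letter-at-start 1) (trans (sym (letter-at-start 2)) (cong (u (3 + K)) (+-comm (3 + K) 1))))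
  overlap-free : ¬ HasOverlap (u (3 + K))
  overlap-free has-overlap with HasOverlap⇒Overlap {u (3 + K)} has-overlap
  ... | q , _ , 0<q , ov = no-overlap q 0<q ov
  squares : ∀ n → HasSquareOfPeriodAtLeast (u (3 + K)) n
  squares n with squares-unbounded {1} {3 + K} (s≤s z≤n) square-0′0′ n
  ... | I , d , n≤q , square = I , d , n≤q , Square⇒PowerAt {u (3 + K)} square
  exponents = exponents-sup-2 {u (3 + K)} overlap-free squares
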